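{- Let $G,H$ be undirected graphs with $E(H)\neq\emptyset$ and let $M$ be a ring. The following are equivalent: (1) for some orientation $\vec G$ of $G$ and some orientation $\vec H$ of $H$ there is an $M$-tension-continuous mapping $\vec G\to\vec H$; (2) for every orientation $\vec H$ of $H$ there is an orientation $\vec G$ of $G$ and an $M$-tension-continuous mapping $\vec G\to\vec H$; (3) there is an $M$-tension-continuous mapping from the symmetric orientation of $G$ to the symmetric orientation of $H$.
   Context: Graphs are finite, with multiple edges and loops allowed. The symmetric orientation of an undirected graph is the directed graph on the same vertex set in which every edge is replaced by two oppositely oriented edges. A ring is associative with unity. A circuit is a connected subgraph in which every vertex is incident with exactly two edge-ends; for a circuit with chosen traversal direction, $C^+$/$C^-$ are its edges traversed forwards/backwards. An $M$-tension on a directed graph $D$ is $\tau:E(D)\to M$ with $\sum_{e\in C^+}\tau(e)=\sum_{e\in C^- }\tau(e)$ for every circuit $C$. A map $f:E(D)\to E(D')$ between directed graphs is $M$-tension-continuous if $\tau\circ f$ is an $M$-tension on $D$ for every $M$-tension $\tau$ on $D'$. -}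

module Defs where

open import Level using (Level; _⊔_)
open import Data.Nat using (ℕ; zero; suc; _<_) renaming (_+_ to _+ℕ_)
open import Data.Fin using (Fin; zero; suc; inject₁; fromℕ; splitAt)
open import Data.Bool using (Bool; true; false; if_then_else_)
open import Data.Product using (_×_; _,_; proj₁; proj₂; Σ)
open import Data.Sum using (_⊎_; inj₁; inj₂)
open import Function using (_∘_)
open import Function.Definitions using (Injective)
open import Relation.Binary.PropositionalEquality using (_≡_)
open import Algebra.Bundles using (Ring)

-- Undirected multigraph (loops and parallel edges allowed):
-- vertex set Fin V, edge set Fin E; edge e has the (unordered) pair of
-- ends  end₁ e, end₂ e  (the order of the two ends carries no meaning).
record Graph : Set where
  field
    V    : ℕ
    E    : ℕ
    end₁ : Fin E → Fin V
    end₂ : Fin E → Fin V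

record Digraph : Set where
  field
    V    : ℕ
    E    : ℕ
    tail : Fin E → Fin V
    head : Fin E → Fin V

Orientation : Graph → Set
Orientation G = Fin (Graph.E G) → Bool

orient : (G : Graph) → Orientation G → Digraph
orient G o = record
  { V = Graph.V G
  ; E = Graph.E G
  ; tail = λ e → if o e then Graph.end₁ G e else Graph.end₂ G e
  ; head = λ e → if o e then Graph.end₂ G e else Graph.end₁ G e
  }

-- Symmetric orientation: every edge e replaced by two oppositely oriented
-- edges (the copy in the left summand end₁ → end₂, the right one end₂ → end₁).
symmetric : Graph → Digraph
symmetric G = record
  { V = Graph.V G
  ; E = Graph.E G +ℕ Graph.E G
  ; tail = λ j → tl (splitAt (Graph.E G) j)
  ; head = λ j → hd (splitAt (Graph.E G) j)
  }
  where
  tl : Fin (Graph.E G) ⊎ Fin (Graph.E G) → Fin (Graph.V G)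
  tl (inj₁ e) = Graph.end₁ G e
  tl (inj₂ e) = Graph.end₂ G e
  hd : Fin (Graph.E G) ⊎ Fin (Graph.E G) → Fin (Graph.V G)
  hd (inj₁ e) = Graph.end₂ G e
  hd (inj₂ e) = Graph.end₁ G e

-- A circuit of D with a chosen traversal direction, of length k = suc m:
-- distinct vertices v 0, …, v m (with v (m+1) = v 0 closing it up) and
-- distinct edges e 0, …, e m, where edge e i joins v i to v (i+1) and is
-- traversed forwards (fwd i = true, e i ∈ C⁺) or backwards (e i ∈ C⁻).
-- This is exactly a connected subgraph with all degrees 2, with a traversal.
record Circuit (D : Digraph) : Set where
  field
    m     : ℕ
    v     : Fin (suc (suc m)) → Fin (Digraph.V D)
    e     : Fin (suc m) → Fin (Digraph.E D)
    fwd   : Fin (suc m) → Bool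
    closed    : v (fromℕ (suc m)) ≡ v zero
    v-inj     : Injective _≡_ _≡_ (v ∘ inject₁)
    e-inj     : Injective _≡_ _≡_ e
    step-tail : ∀ i → Digraph.tail D (e i) ≡ (if fwd i then v (inject₁ i) else v (suc i))
    step-head : ∀ i → Digraph.head D (e i) ≡ (if fwd i then v (suc i) else v (inject₁ i))

module _ {c ℓ : Level} (M : Ring c ℓ) where
  open Ring M using (Carrier; _≈_; _+_; 0#)

  Σ-fin : ∀ {n} → (Fin n → Carrier) → Carrier
  Σ-fin {zero}  f = 0#
  Σ-fin {suc n} f = f zero + Σ-fin (f ∘ suc)

  IsTension : (D : Digraph) → (Fin (Digraph.E D) → Carrier) → Set ℓ
  IsTension D τ = (C : Circuit D) →
    let open Circuit C in
    Σ-fin (λ i → if fwd i then τ (e i) else 0#)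
      ≈ Σ-fin (λ i → if fwd i then 0# else τ (e i))

  TensionContinuous : (D D' : Digraph) → (Fin (Digraph.E D) → Fin (Digraph.E D')) → Set (c ⊔ ℓ)
  TensionContinuous D D' f = (τ : Fin (Digraph.E D') → Carrier) →
    IsTension D' τ → IsTension D (τ ∘ f)

-- A tension pulls back along any edge map sending every edge to an edge between the images
-- of its ends, possibly reversed, provided reversed edges receive the negated value: the
-- image of a circuit is a closed walk through distinct vertices, which is either a circuit
-- or traverses a single edge back and forth, and in both cases the tension sums to 0 along
-- it. Reorienting edges, including an orientation into the symmetric orientation, and
-- collapsing the symmetric orientation onto an orientation are all such maps. Moreover a
-- tension of the symmetric orientation takes opposite values on the two copies of an edge,
-- which form a circuit of length 2 (or two loops), so only the image of one copy of each
-- edge matters.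
module Submission where

open import Defs
open import Level using (Level)
open import Data.Nat using (ℕ; zero; suc; _<_) renaming (_+_ to _+ℕ_)
open import Data.Nat.Properties using (<⇒≢; n<1+n; m<n⇒m<1+n)
open import Data.Fin using (Fin; zero; suc; inject₁; fromℕ; toℕ; splitAt; _↑ˡ_; _↑ʳ_)
open import Data.Fin.Properties using (toℕ-injective; any?; splitAt-↑ˡ; splitAt-↑ʳ)
  renaming (_≟_ to _≟ᶠ_)
open import Data.Bool using (Bool; true; false; if_then_else_; not; _xor_)
open import Data.Bool.Properties using (if-float; if-xor)
open import Data.Product using (_×_; _,_; Σ; ∃)
open import Data.Sum using (_⊎_; inj₁; inj₂; [_,_]′)
open import Data.Empty using (⊥-elim)
open import Function using (_∘_; id; const)
open import Function.Definitions using (Injective)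
open import Relation.Binary.PropositionalEquality as ≡ using (_≡_; _≢_; refl; cong)
open import Relation.Nullary using (yes; no)
open import Relation.Nullary.Decidable using (_×-dec_; ¬?)
open import Algebra.Bundles using (Ring)
import Algebra.Properties.Ring as RingProperties
import Algebra.Properties.CommutativeSemigroup as CommutativeSemigroupProperties
import Relation.Binary.Reasoning.Setoid as SetoidReasoning

-- A circuit except that edges may repeat; circuits are mapped to such walks.
record SimpleClosedWalk (D : Digraph) : Set where
  field
    m         : ℕ
    v         : Fin (suc (suc m)) → Fin (Digraph.V D)
    e         : Fin (suc m) → Fin (Digraph.E D)
    fwd       : Fin (suc m) → Bool
    closed    : v (fromℕ (suc m)) ≡ v zero
    v-inj     : Injective _≡_ _≡_ (v ∘ inject₁)
    step-tail : ∀ i → Digraph.tail D (e i) ≡ (if fwd i then v (inject₁ i) else v (suc i))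
    step-head : ∀ i → Digraph.head D (e i) ≡ (if fwd i then v (suc i) else v (inject₁ i))

toCircuit : ∀ {D} (W : SimpleClosedWalk D) →
            Injective _≡_ _≡_ (SimpleClosedWalk.e W) → Circuit D
toCircuit W e-inj = record { SimpleClosedWalk W ; e-inj = e-inj }

IsCyclicSucc : ∀ {m} → Fin (suc m) → Fin (suc m) → Set
IsCyclicSucc {m} i k = toℕ i ≡ suc (toℕ k) ⊎ (toℕ i ≡ 0 × toℕ k ≡ m)

suc≡inject₁⊎suc≡last : ∀ {m} (k : Fin (suc m)) →
  (∃ λ k′ → suc k ≡ inject₁ k′ × toℕ k′ ≡ suc (toℕ k)) ⊎ (suc k ≡ fromℕ (suc m) × toℕ k ≡ m)
suc≡inject₁⊎suc≡last {zero}  zero    = inj₂ (refl , refl)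
suc≡inject₁⊎suc≡last {suc m} zero    = inj₁ (suc zero , refl , refl)
suc≡inject₁⊎suc≡last {suc m} (suc k) with suc≡inject₁⊎suc≡last k
... | inj₁ (k′ , p , q) = inj₁ (suc k′ , cong suc p , cong suc q)
... | inj₂ (p , q)      = inj₂ (cong suc p , cong suc q)

cyclicSucc-mutual⇒m≡1 : ∀ {m} {i k : Fin (suc m)} → i ≢ k →
                        IsCyclicSucc i k → IsCyclicSucc k i → m ≡ 1
cyclicSucc-mutual⇒m≡1 {i = i} _ (inj₁ p) (inj₁ q) =
  ⊥-elim (<⇒≢ (m<n⇒m<1+n (n<1+n (toℕ i))) (≡.trans p (cong suc q)))
cyclicSucc-mutual⇒m≡1 _ (inj₁ p) (inj₂ (q , r)) = ≡.trans (≡.sym r) (≡.trans p (cong suc q))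
cyclicSucc-mutual⇒m≡1 _ (inj₂ (p , r)) (inj₁ q) = ≡.trans (≡.sym r) (≡.trans q (cong suc p))
cyclicSucc-mutual⇒m≡1 i≢k (inj₂ (p , _)) (inj₂ (q , _)) =
  ⊥-elim (i≢k (toℕ-injective (≡.trans p (≡.sym q))))

traversals-of-one-edge : ∀ {A : Set} (f f′ : Bool) {t h a b c d : A} →
  t ≡ (if f then a else b) → h ≡ (if f then b else a) →
  t ≡ (if f′ then c else d) → h ≡ (if f′ then d else c) →
  a ≡ c ⊎ (a ≡ d × b ≡ c × f ≢ f′)
traversals-of-one-edge true  true  t₁ _  t₂ _  = inj₁ (≡.trans (≡.sym t₁) t₂)
traversals-of-one-edge false false _  h₁ _  h₂ = inj₁ (≡.trans (≡.sym h₁) h₂)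
traversals-of-one-edge true  false t₁ h₁ t₂ h₂ =
  inj₂ (≡.trans (≡.sym t₁) t₂ , ≡.trans (≡.sym h₁) h₂ , λ ())
traversals-of-one-edge false true  t₁ h₁ t₂ h₂ =
  inj₂ (≡.trans (≡.sym h₁) h₂ , ≡.trans (≡.sym t₁) t₂ , λ ())

module _ {D : Digraph} (W : SimpleClosedWalk D) where
  open SimpleClosedWalk W

  same-vertex⇒cyclicSucc : ∀ i k → v (inject₁ i) ≡ v (suc k) → IsCyclicSucc i k
  same-vertex⇒cyclicSucc i k vᵢ≡vₖ₊₁ with suc≡inject₁⊎suc≡last k
  ... | inj₁ (k′ , p , q) = inj₁ (≡.trans (cong toℕ (v-inj (≡.trans vᵢ≡vₖ₊₁ (cong v p)))) q)
  ... | inj₂ (p , q)      =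
    inj₂ (cong toℕ (v-inj {i} {zero} (≡.trans vᵢ≡vₖ₊₁ (≡.trans (cong v p) closed))) , q)

  -- The two ends of a repeated edge are consecutive vertices both ways round.
  repeated-edge : ∀ {i k} → i ≢ k → e i ≡ e k → m ≡ 1 × fwd i ≢ fwd k
  repeated-edge {i} {k} i≢k eᵢ≡eₖ
    with traversals-of-one-edge (fwd i) (fwd k) (step-tail i) (step-head i)
           (≡.trans (cong (Digraph.tail D) eᵢ≡eₖ) (step-tail k))
           (≡.trans (cong (Digraph.head D) eᵢ≡eₖ) (step-head k))
  ... | inj₁ vᵢ≡vₖ = ⊥-elim (i≢k (v-inj vᵢ≡vₖ))
  ... | inj₂ (vᵢ≡vₖ₊₁ , vᵢ₊₁≡vₖ , fᵢ≢fₖ) =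
    cyclicSucc-mutual⇒m≡1 i≢k (same-vertex⇒cyclicSucc i k vᵢ≡vₖ₊₁)
                              (same-vertex⇒cyclicSucc k i (≡.sym vᵢ₊₁≡vₖ)) ,
    fᵢ≢fₖ

ends-reoriented : ∀ {A : Set} r o {a b : A} →
  (if o then a else b) ≡ (if r xor o then (if r then b else a) else (if r then a else b))
ends-reoriented true  true  = refl
ends-reoriented true  false = refl
ends-reoriented false true  = refl
ends-reoriented false false = refl

xor-cancelʳ : ∀ a b → (a xor b) xor b ≡ a
xor-cancelʳ true  true  = refl
xor-cancelʳ true  false = refl
xor-cancelʳ false true  = refl
xor-cancelʳ false false = refl

record SignedHom (D D′ : Digraph) : Set where
  field
    vertex           : Fin (Digraph.V D) → Fin (Digraph.V D′)
    vertex-injective : Injective _≡_ _≡_ vertex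
    edge             : Fin (Digraph.E D) → Fin (Digraph.E D′)
    reversed         : Fin (Digraph.E D) → Bool
    tail-edge        : ∀ x → Digraph.tail D′ (edge x)
                           ≡ vertex (if reversed x then Digraph.head D x else Digraph.tail D x)
    head-edge        : ∀ x → Digraph.head D′ (edge x)
                           ≡ vertex (if reversed x then Digraph.tail D x else Digraph.head D x)

mapCircuit : ∀ {D D′} → SignedHom D D′ → Circuit D → SimpleClosedWalk D′
mapCircuit h C = record
  { m         = m
  ; v         = vertex ∘ v
  ; e         = edge ∘ e
  ; fwd       = fwd′
  ; closed    = cong vertex closed
  ; v-inj     = v-inj ∘ vertex-injective
  ; step-tail = λ i → ≡.trans (tail-edge (e i)) (ends (step-head i) (step-tail i))
  ; step-head = λ i → ≡.trans (head-edge (e i)) (ends (step-tail i) (step-head i))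
  }
  where
  open SignedHom h
  open Circuit C
  fwd′ : Fin (suc m) → Bool
  fwd′ i = reversed (e i) xor fwd i
  ends : ∀ {i} {x y a b} → x ≡ (if fwd i then b else a) → y ≡ (if fwd i then a else b) →
         vertex (if reversed (e i) then x else y) ≡ (if fwd′ i then vertex a else vertex b)
  ends {i} refl refl = ≡.trans (cong vertex (≡.sym (if-xor (reversed (e i)))))
                               (if-float vertex (fwd′ i))

module _ {c ℓ : Level} (M : Ring c ℓ) where
  open Ring M hiding (zero; refl; sym; trans)
  open Ring M using () renaming (refl to ≈-refl; sym to ≈-sym; trans to ≈-trans)
  open RingProperties M using (-‿involutive; -0#≈0#; +-identityˡ-unique; +-inverseʳ-unique)
  open CommutativeSemigroupProperties +-commutativeSemigroup using (interchange)
  open SetoidReasoning setoid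

  negateIf : Bool → Carrier → Carrier
  negateIf b x = if b then - x else x

  negateIf-involutive : ∀ b x → negateIf b (negateIf b x) ≈ x
  negateIf-involutive true  x = -‿involutive x
  negateIf-involutive false x = ≈-refl

  Σ-fin-cong : ∀ {n} {a b : Fin n → Carrier} → (∀ i → a i ≈ b i) → Σ-fin M a ≈ Σ-fin M b
  Σ-fin-cong {zero}  _   = ≈-refl
  Σ-fin-cong {suc n} a≈b = +-cong (a≈b zero) (Σ-fin-cong (a≈b ∘ suc))

  module _ {n : ℕ} (fwd : Fin n → Bool) (a : Fin n → Carrier) where

    forwardSum backwardSum circulation : Carrier
    forwardSum  = Σ-fin M (λ i → if fwd i then a i else 0#)
    backwardSum = Σ-fin M (λ i → if fwd i then 0# else a i)
    circulation = Σ-fin M (λ i → if fwd i then a i else - a i)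

  forwardSum≈circulation+backwardSum : ∀ {n} (fwd : Fin n → Bool) a →
    forwardSum fwd a ≈ circulation fwd a + backwardSum fwd a
  forwardSum≈circulation+backwardSum {zero}  _   _ = ≈-sym (+-identityʳ 0#)
  forwardSum≈circulation+backwardSum {suc n} fwd a = begin
    term (fwd zero) + forwardSum (fwd ∘ suc) (a ∘ suc)
      ≈⟨ +-cong (term≈ (fwd zero)) (forwardSum≈circulation+backwardSum (fwd ∘ suc) (a ∘ suc)) ⟩
    _ + (circulation (fwd ∘ suc) (a ∘ suc) + backwardSum (fwd ∘ suc) (a ∘ suc))
      ≈⟨ interchange _ _ _ _ ⟩
    circulation fwd a + backwardSum fwd a ∎
    where
    term : Bool → Carrier
    term f = if f then a zero else 0#
    term≈ : ∀ f → term f ≈ (if f then a zero else - a zero) + (if f then 0# else a zero)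
    term≈ true  = ≈-sym (+-identityʳ (a zero))
    term≈ false = ≈-sym (-‿inverseˡ (a zero))

  balanced⇒circulation≈0 : ∀ {n} (fwd : Fin n → Bool) a →
    forwardSum fwd a ≈ backwardSum fwd a → circulation fwd a ≈ 0#
  balanced⇒circulation≈0 fwd a balanced = +-identityˡ-unique _ _
    (≈-trans (≈-sym (forwardSum≈circulation+backwardSum fwd a)) balanced)

  circulation≈0⇒balanced : ∀ {n} (fwd : Fin n → Bool) a →
    circulation fwd a ≈ 0# → forwardSum fwd a ≈ backwardSum fwd a
  circulation≈0⇒balanced fwd a circ≈0 = begin
    forwardSum fwd a                      ≈⟨ forwardSum≈circulation+backwardSum fwd a ⟩
    circulation fwd a + backwardSum fwd a ≈⟨ +-congʳ circ≈0 ⟩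
    0# + backwardSum fwd a                ≈⟨ +-identityˡ _ ⟩
    backwardSum fwd a                     ∎

  circulation-retraced : ∀ {m} → m ≡ 1 → (fwd : Fin (suc m) → Bool) (a : Fin (suc m) → Carrier) →
    ∀ {i k} → i ≢ k → a i ≡ a k → fwd i ≢ fwd k → circulation fwd a ≈ 0#
  circulation-retraced refl fwd a {zero}     {zero}     i≢k _ _ = ⊥-elim (i≢k refl)
  circulation-retraced refl fwd a {suc zero} {suc zero} i≢k _ _ = ⊥-elim (i≢k refl)
  circulation-retraced refl fwd a {zero}     {suc zero} _ a₀≡a₁ f₀≢f₁ =
    opposite (fwd zero) (fwd (suc zero)) a₀≡a₁ f₀≢f₁
    where
    opposite : ∀ f f′ {x y} → x ≡ y → f ≢ f′ →
      (if f then x else - x) + ((if f′ then y else - y) + 0#) ≈ 0#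
    opposite true  true  _    f≢f′ = ⊥-elim (f≢f′ refl)
    opposite false false _    f≢f′ = ⊥-elim (f≢f′ refl)
    opposite true  false refl _    = ≈-trans (+-congˡ (+-identityʳ _)) (-‿inverseʳ _)
    opposite false true  refl _    = ≈-trans (+-congˡ (+-identityʳ _)) (-‿inverseˡ _)
  circulation-retraced refl fwd a {suc zero} {zero} i≢k a₁≡a₀ f₁≢f₀ =
    circulation-retraced refl fwd a (i≢k ∘ ≡.sym) (≡.sym a₁≡a₀) (f₁≢f₀ ∘ ≡.sym)

  module _ {D : Digraph} (τ : Fin (Digraph.E D) → Carrier) (T : IsTension M D τ)
           (W : SimpleClosedWalk D) where
    open SimpleClosedWalk W

    circulation-walk≈0 : circulation fwd (τ ∘ e) ≈ 0#
    circulation-walk≈0 with any? (λ i → any? (λ k → ¬? (i ≟ᶠ k) ×-dec (e i ≟ᶠ e k)))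
    ... | yes (i , k , i≢k , eᵢ≡eₖ) =
      let (m≡1 , fᵢ≢fₖ) = repeated-edge W i≢k eᵢ≡eₖ
      in circulation-retraced m≡1 fwd (τ ∘ e) i≢k (cong τ eᵢ≡eₖ) fᵢ≢fₖ
    ... | no no-repeat = balanced⇒circulation≈0 fwd (τ ∘ e) (T (toCircuit W e-inj))
      where
      e-inj : Injective _≡_ _≡_ e
      e-inj {i} {k} eᵢ≡eₖ with i ≟ᶠ k
      ... | yes i≡k = i≡k
      ... | no  i≢k = ⊥-elim (no-repeat (i , k , i≢k , eᵢ≡eₖ))

  signedPullback-isTension : ∀ {D D′} (h : SignedHom D D′) →
    let open SignedHom h in
    ∀ τ τ′ → (∀ x → τ x ≈ negateIf (reversed x) (τ′ (edge x))) →
    IsTension M D′ τ′ → IsTension M D τ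
  signedPullback-isTension h τ τ′ τ≈ T′ C =
    circulation≈0⇒balanced fwd (τ ∘ e)
      (≈-trans (Σ-fin-cong term≈) (circulation-walk≈0 τ′ T′ (mapCircuit h C)))
    where
    open SignedHom h
    open Circuit C
    signs : ∀ r f y → (if f then negateIf r y else - negateIf r y) ≈ (if r xor f then y else - y)
    signs true  true  y = ≈-refl
    signs true  false y = -‿involutive y
    signs false true  y = ≈-refl
    signs false false y = ≈-refl
    term≈ : ∀ i → (if fwd i then τ (e i) else - τ (e i))
                ≈ (if reversed (e i) xor fwd i then τ′ (edge (e i)) else - τ′ (edge (e i)))
    term≈ i with fwd i | signs (reversed (e i)) (fwd i) (τ′ (edge (e i)))
    ... | true  | s = ≈-trans (τ≈ (e i)) s
    ... | false | s = ≈-trans (-‿cong (τ≈ (e i))) s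

  module _ {D : Digraph} (τ : Fin (Digraph.E D) → Carrier) (T : IsTension M D τ) where
    open Digraph D

    tension-loop≈0 : ∀ x → tail x ≡ head x → τ x ≈ 0#
    tension-loop≈0 x loop = begin
      τ x        ≈⟨ +-identityʳ (τ x) ⟨
      τ x + 0#   ≈⟨ T loopCircuit ⟩
      0# + 0#    ≈⟨ +-identityʳ 0# ⟩
      0#         ∎
      where
      loopCircuit : Circuit D
      loopCircuit = record
        { m = 0 ; v = const (tail x) ; e = const x ; fwd = const true ; closed = refl
        ; v-inj = λ { {zero} {zero} _ → refl } ; e-inj = λ { {zero} {zero} _ → refl }
        ; step-tail = λ { zero → refl } ; step-head = λ { zero → ≡.sym loop } }

    tension-digon : ∀ x y → tail x ≢ head x → tail y ≡ head x → head y ≡ tail x →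
                    τ y ≈ - τ x
    tension-digon x y non-loop tailʸ headʸ = +-inverseʳ-unique (τ x) (τ y) (begin
      τ x + τ y          ≈⟨ +-congˡ (+-identityʳ (τ y)) ⟨
      τ x + (τ y + 0#)   ≈⟨ T digon ⟩
      0# + (0# + 0#)     ≈⟨ +-identityˡ _ ⟩
      0# + 0#            ≈⟨ +-identityʳ 0# ⟩
      0#                 ∎)
      where
      v : Fin 3 → Fin V
      v zero             = tail x
      v (suc zero)       = head x
      v (suc (suc zero)) = tail x
      w : Fin 2 → Fin E
      w zero       = x
      w (suc zero) = y
      v-inj : Injective _≡_ _≡_ (v ∘ inject₁)
      v-inj {zero}     {zero}     _ = refl
      v-inj {zero}     {suc zero} p = ⊥-elim (non-loop p)
      v-inj {suc zero} {zero}     p = ⊥-elim (non-loop (≡.sym p))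
      v-inj {suc zero} {suc zero} _ = refl
      x≢y : x ≢ y
      x≢y refl = non-loop tailʸ
      w-inj : Injective _≡_ _≡_ w
      w-inj {zero}     {zero}     _ = refl
      w-inj {zero}     {suc zero} p = ⊥-elim (x≢y p)
      w-inj {suc zero} {zero}     p = ⊥-elim (x≢y (≡.sym p))
      w-inj {suc zero} {suc zero} _ = refl
      digon : Circuit D
      digon = record
        { m = 1 ; v = v ; e = w ; fwd = const true ; closed = refl ; v-inj = v-inj ; e-inj = w-inj
        ; step-tail = λ { zero → refl ; (suc zero) → tailʸ }
        ; step-head = λ { zero → refl ; (suc zero) → headʸ } }

module SymmetricOrientation (G : Graph) where
  open Graph G

  arc : Bool → Fin E → Fin (E +ℕ E)
  arc true  x = x ↑ˡ E
  arc false x = E ↑ʳ x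

  tail-arc : ∀ b x → Digraph.tail (symmetric G) (arc b x) ≡ (if b then end₁ x else end₂ x)
  tail-arc true  x rewrite splitAt-↑ˡ E x E = refl
  tail-arc false x rewrite splitAt-↑ʳ E E x = refl

  head-arc : ∀ b x → Digraph.head (symmetric G) (arc b x) ≡ (if b then end₂ x else end₁ x)
  head-arc true  x rewrite splitAt-↑ˡ E x E = refl
  head-arc false x rewrite splitAt-↑ʳ E E x = refl

  underlying : Fin (E +ℕ E) → Fin E
  underlying j = [ id , id ]′ (splitAt E j)

  direction : Fin (E +ℕ E) → Bool
  direction j = [ const true , const false ]′ (splitAt E j)

  inclusion : (o : Orientation G) → SignedHom (orient G o) (symmetric G)
  inclusion o = record
    { vertex = id ; vertex-injective = id ; edge = λ x → arc (o x) x ; reversed = const false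
    ; tail-edge = λ x → tail-arc (o x) x ; head-edge = λ x → head-arc (o x) x }

  reorient : (o o′ : Orientation G) → SignedHom (orient G o) (orient G o′)
  reorient o o′ = record
    { vertex = id ; vertex-injective = id ; edge = id ; reversed = λ x → o x xor o′ x
    ; tail-edge = λ x → ends-reoriented (o x) (o′ x)
    ; head-edge = λ x → ends-reoriented (o x) (o′ x) }

  collapse : (o : Orientation G) → SignedHom (symmetric G) (orient G o)
  collapse o = record
    { vertex = id ; vertex-injective = id ; edge = underlying
    ; reversed = λ j → direction j xor o (underlying j)
    ; tail-edge = collapse-tail ; head-edge = collapse-head }
    where
    collapse-tail : ∀ j → Digraph.tail (orient G o) (underlying j)
      ≡ (if direction j xor o (underlying j)
         then Digraph.head (symmetric G) j else Digraph.tail (symmetric G) j)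
    collapse-tail j with splitAt E j
    ... | inj₁ x = ends-reoriented true  (o x)
    ... | inj₂ x = ends-reoriented false (o x)
    collapse-head : ∀ j → Digraph.head (orient G o) (underlying j)
      ≡ (if direction j xor o (underlying j)
         then Digraph.tail (symmetric G) j else Digraph.head (symmetric G) j)
    collapse-head j with splitAt E j
    ... | inj₁ x = ends-reoriented true  (o x)
    ... | inj₂ x = ends-reoriented false (o x)

  module _ {c ℓ : Level} (M : Ring c ℓ) where
    open Ring M hiding (zero; refl; sym; trans)
    open Ring M using () renaming (refl to ≈-refl; sym to ≈-sym; trans to ≈-trans)
    open RingProperties M using (-0#≈0#)

    tension-reversed-arc : ∀ σ → IsTension M (symmetric G) σ →
                           ∀ b x → σ (arc (not b) x) ≈ negateIf M b (σ (arc true x))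
    tension-reversed-arc σ T false x = ≈-refl
    tension-reversed-arc σ T true x with end₁ x ≟ᶠ end₂ x
    ... | no non-loop = tension-digon M σ T (arc true x) (arc false x)
                          (λ p → non-loop (≡.trans (≡.sym (tail-arc true x))
                                                    (≡.trans p (head-arc true x))))
                          (≡.trans (tail-arc false x) (≡.sym (head-arc true x)))
                          (≡.trans (head-arc false x) (≡.sym (tail-arc true x)))
    ... | yes loop = ≈-trans (loop≈0 false) (≈-trans (≈-sym -0#≈0#) (-‿cong (≈-sym (loop≈0 true))))
      where
      loop≈0 : ∀ b → σ (arc b x) ≈ 0#
      loop≈0 b = tension-loop≈0 M σ T (arc b x) (begin
        Digraph.tail (symmetric G) (arc b x) ≡⟨ tail-arc b x ⟩
        (if b then end₁ x else end₂ x)       ≡⟨ cong (λ y → if b then end₁ x else y) (≡.sym loop) ⟩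
        (if b then end₁ x else end₁ x)       ≡⟨ cong (λ y → if b then y else end₁ x) loop ⟩
        (if b then end₂ x else end₁ x)       ≡⟨ head-arc b x ⟨
        Digraph.head (symmetric G) (arc b x) ∎)
        where open ≡.≡-Reasoning

module _ {c ℓ : Level} (M : Ring c ℓ) (G H : Graph) where
  open Ring M hiding (zero; refl; sym; trans)
  open Ring M using () renaming (refl to ≈-refl; sym to ≈-sym; trans to ≈-trans)
  module SG = SymmetricOrientation G
  module SH = SymmetricOrientation H

  reorient-continuous : ∀ {oG oH} f → TensionContinuous M (orient G oG) (orient H oH) f →
    (oH′ : Orientation H) →
    TensionContinuous M (orient G (λ x → (oH (f x) xor oH′ (f x)) xor oG x)) (orient H oH′) f
  reorient-continuous {oG} {oH} f tc oH′ τ′ T′ =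
    signedPullback-isTension M (SG.reorient oG′ oG) (τ′ ∘ f) (τ ∘ f) τ′∘f≈
      (tc τ (signedPullback-isTension M (SH.reorient oH oH′) τ τ′ (λ _ → ≈-refl) T′))
    where
    flipped : Fin (Graph.E H) → Bool
    flipped h = oH h xor oH′ h
    oG′ : Orientation G
    oG′ x = flipped (f x) xor oG x
    τ : Fin (Graph.E H) → Carrier
    τ h = negateIf M (flipped h) (τ′ h)
    τ′∘f≈ : ∀ x → τ′ (f x) ≈ negateIf M (oG′ x xor oG x) (τ (f x))
    τ′∘f≈ x rewrite xor-cancelʳ (flipped (f x)) (oG x) =
      ≈-sym (negateIf-involutive M (flipped (f x)) (τ′ (f x)))

  symmetrize : ∀ {oG} f → TensionContinuous M (orient G oG) (orient H (const true)) f →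
    Σ (Fin (Digraph.E (symmetric G)) → Fin (Digraph.E (symmetric H))) λ F →
      TensionContinuous M (symmetric G) (symmetric H) F
  symmetrize {oG} f tc = F , λ σ T →
    signedPullback-isTension M collapse (σ ∘ F) (σ ∘ SH.arc true ∘ f) (σF≈ σ T)
      (tc (σ ∘ SH.arc true)
          (signedPullback-isTension M (SH.inclusion (const true)) (σ ∘ SH.arc true) σ
                                    (λ _ → ≈-refl) T))
    where
    collapse = SG.collapse oG
    open SignedHom collapse using (edge; reversed)
    F : Fin (Digraph.E (symmetric G)) → Fin (Digraph.E (symmetric H))
    F j = SH.arc (not (reversed j)) (f (edge j))
    σF≈ : ∀ σ → IsTension M (symmetric H) σ →
          ∀ j → σ (F j) ≈ negateIf M (reversed j) (σ (SH.arc true (f (edge j))))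
    σF≈ σ T j = SH.tension-reversed-arc M σ T (reversed j) (f (edge j))

  desymmetrize : ∀ F → TensionContinuous M (symmetric G) (symmetric H) F →
    (oH : Orientation H) → Σ (Orientation G) λ oG → Σ (Fin (Graph.E G) → Fin (Graph.E H)) λ f →
      TensionContinuous M (orient G oG) (orient H oH) f
  desymmetrize F tc oH = oG , f , λ τ T →
    signedPullback-isTension M (SG.inclusion oG) (τ ∘ f) (lifted τ ∘ F) (τ∘f≈ τ T)
      (tc (lifted τ) (lifted-isTension τ T))
    where
    collapse = SH.collapse oH
    open SignedHom collapse using (edge; reversed)
    f : Fin (Graph.E G) → Fin (Graph.E H)
    f x = edge (F (SG.arc true x))
    oG : Orientation G
    oG x = not (reversed (F (SG.arc true x)))
    lifted : (Fin (Graph.E H) → Carrier) → Fin (Digraph.E (symmetric H)) → Carrier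
    lifted τ j = negateIf M (reversed j) (τ (edge j))
    lifted-isTension : ∀ τ → IsTension M (orient H oH) τ → IsTension M (symmetric H) (lifted τ)
    lifted-isTension τ = signedPullback-isTension M collapse (lifted τ) τ (λ _ → ≈-refl)
    τ∘f≈ : ∀ τ → IsTension M (orient H oH) τ → ∀ x → τ (f x) ≈ lifted τ (F (SG.arc (oG x) x))
    τ∘f≈ τ T x = ≈-sym (≈-trans
      (SG.tension-reversed-arc M (lifted τ ∘ F) (tc (lifted τ) (lifted-isTension τ T)) r x)
      (negateIf-involutive M r (τ (f x))))
      where r = reversed (F (SG.arc true x))

proposition2 : {c ℓ : Level} (M : Ring c ℓ) (G H : Graph) → 0 < Graph.E H →
    let
      S1 = Σ (Orientation G) (λ oG → Σ (Orientation H) (λ oH →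
             Σ (Fin (Graph.E G) → Fin (Graph.E H)) (λ f →
               TensionContinuous M (orient G oG) (orient H oH) f)))
      S2 = (oH : Orientation H) → Σ (Orientation G) (λ oG →
             Σ (Fin (Graph.E G) → Fin (Graph.E H)) (λ f →
               TensionContinuous M (orient G oG) (orient H oH) f))
      S3 = Σ (Fin (Digraph.E (symmetric G)) → Fin (Digraph.E (symmetric H))) (λ f →
             TensionContinuous M (symmetric G) (symmetric H) f)
    in ((S1 → S2) × (S2 → S1)) × ((S2 → S3) × (S3 → S2))
proposition2 M G H _ =
  ((λ { (_ , _ , f , tc) oH′ → _ , f , reorient-continuous M G H f tc oH′ }) ,
   (λ s2 → let (oG , f , tc) = s2 (const true) in oG , const true , f , tc)) ,
  ((λ s2 → let (_ , f , tc) = s2 (const true) in symmetrize M G H f tc) ,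
   (λ { (F , tc) → desymmetrize M G H F tc }))
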